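{- Let $p\geq 7$ be a prime and let $\varphi$ denote Euler's totient function. If $\varphi(x)=4p$ for some positive integer $x$, then $T(p)=\{3,5,2p+1\}$ or $T(p)=\{3,5,4p+1\}$. Otherwise, $T(p)=\{3,5\}$.
   Context: For an integer $n$, a Toda prime of $n$ is an odd prime $q$ such that $q-1\mid 4n$ and $\gcd\!\left(q,\frac{4n}{q-1}\right)=1$. $T(n)$ denotes the set of Toda primes of $n$. -}

module Defs where

open import Data.Nat using (ℕ; zero; suc; _+_; _*_; _∸_; _≤_; _≟_)
open import Data.Nat.GCD using (gcd)
open import Data.Nat.Divisibility using (_∣_; divides)
open import Data.Nat.Primality using (Prime)
open import Data.List using (List; length; filter; upTo; map)
open import Data.Product using (_×_; Σ; ∃)
open import Relation.Binary.PropositionalEquality using (_≡_)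
open import Relation.Nullary using (¬_)

φ : ℕ → ℕ
φ x = length (filter (λ k → gcd k x ≟ 1) (map suc (upTo x)))

-- q is a Toda prime of n: q odd prime, (q-1) ∣ 4n, and gcd(q, 4n/(q-1)) = 1.
-- The quotient 4n/(q-1) is given as the witness k with 4n = k·(q-1)
-- (unique since q-1 ≥ 2 > 0).
IsTodaPrime : ℕ → ℕ → Set
IsTodaPrime n q =
  Prime q × ¬ (2 ∣ q) ×
  Σ ℕ (λ k → (4 * n ≡ k * (q ∸ 1)) × (gcd q k ≡ 1))

-- The Toda primes of p are the odd primes among d + 1 with d ∣ 4p: always 3 and 5 (p + 1 is even),
-- plus whichever of 2p + 1 and 4p + 1 is prime; never both, since 3 divides one of p, 2p + 1, 4p + 1.
-- So it remains to see that φ(x) = 4p is solvable iff 2p + 1 or 4p + 1 is prime. If so, x = 3(2p + 1)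
-- or x = 4p + 1 works. Conversely, if φ(x) = 4p then p ∣ φ(x); peeling the prime factors r off x
-- with φ(r m) = r φ(m) for r ∣ m and φ(r m) = (r − 1) φ(m) otherwise shows that either p² ∣ x,
-- forcing p(p − 1) ∣ 4p, or x has a prime factor r with p ∣ r − 1 ∣ 4p, forcing r ∈ {2p + 1, 4p + 1}.
-- Both recurrences for φ come from counting the k ∈ [1, r m] coprime to m, a condition periodic
-- in k, and separating off the multiples of r.
module Submission where

open import Defs
open import Data.Nat using (ℕ; _+_; _*_; _≤_)
open import Data.Nat.Primality using (Prime)
open import Data.Product using (_×_; ∃)
open import Data.Sum using (_⊎_)
open import Relation.Binary.PropositionalEquality using (_≡_)
open import Relation.Nullary using (¬_)
open import Function.Bundles using (_⇔_)

open import Data.Bool.Base using (Bool; true; false; _∧_; not; if_then_else_)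
open import Data.Bool.Properties using (∧-identityʳ; ∧-zeroʳ)
open import Data.Empty using (⊥-elim)
open import Data.Fin.Base using (zero; suc)
open import Data.List.Base using (length; filter; applyUpTo)
open import Data.List.Properties using (map-upTo)
open import Data.List.Relation.Unary.All using (All; []; _∷_)
open import Data.Nat.Base
  using (zero; suc; 2+; _∸_; _<_; z≤n; s≤s; NonZero; >-nonZero; nonTrivial⇒n>1)
open import Data.Nat.Coprimality
  using (Coprime; coprime?; coprime-+; coprime-divisor; coprime⇒gcd≡1)
  renaming (sym to coprime-sym)
open import Data.Nat.Divisibility
open import Data.Nat.DivMod using (_divMod_; result)
open import Data.Nat.GCD using (gcd; gcd-zeroʳ)
open import Data.Nat.ListAction using (product)
open import Data.Nat.Primality
  using (prime?; prime[2]; prime⇒irreducible; prime⇒nonZero; prime⇒nonTrivial;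
         ¬prime[0]; ¬prime[1]; euclidsLemma)
open import Data.Nat.Primality.Factorisation using (factorise; PrimeFactorisation)
open import Data.Nat.Properties
open import Data.Nat.Tactic.RingSolver using (solve-∀)
open import Data.Product using (_,_; proj₁)
open import Data.Sum using (inj₁; inj₂; [_,_]′; map₂)
import Data.Sum as Sum
open import Function.Base using (_∘_; id)
open import Function.Bundles using (mk⇔; Equivalence)
open import Relation.Binary.PropositionalEquality
  using (_≢_; refl; sym; trans; cong; cong₂; subst; module ≡-Reasoning)
open import Relation.Nullary using (does; yes; no; contradiction; _×-dec_; ¬?)
open import Relation.Nullary.Decidable using (does-⇔; dec-true; dec-false; from-yes; from-no)
open import Relation.Unary using (Pred; Decidable)

open Equivalence using (to; from)

-- Primes and coprimality

prime[3] : Prime 3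
prime[3] = from-yes (prime? 3)

prime[5] : Prime 5
prime[5] = from-yes (prime? 5)

prime⇒>1 : ∀ {p} → Prime p → 1 < p
prime⇒>1 {p} p-prime = nonTrivial⇒n>1 p {{prime⇒nonTrivial p-prime}}

prime⇒≢1 : ∀ {p} → Prime p → p ≢ 1
prime⇒≢1 p-prime refl = ¬prime[1] p-prime

∣-prime⇒≡ : ∀ {m n} → Prime m → Prime n → m ∣ n → m ≡ n
∣-prime⇒≡ m-prime n-prime m∣n =
  [ (λ m≡1 → contradiction m≡1 (prime⇒≢1 m-prime)) , id ]′ (prime⇒irreducible n-prime m∣n)

prime-coprime⇔∤ : ∀ {p n} → Prime p → Coprime p n ⇔ p ∤ n
prime-coprime⇔∤ {p} {n} p-prime = mk⇔ (λ p⊥n p∣n → prime⇒≢1 p-prime (p⊥n (∣-refl , p∣n))) coprime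
  where
  coprime : p ∤ n → Coprime p n
  coprime p∤n (i∣p , i∣n) with prime⇒irreducible p-prime i∣p
  ... | inj₁ i≡1  = i≡1
  ... | inj₂ refl = contradiction i∣n p∤n

coprime-*⇔ : ∀ {k m n} → Coprime k (m * n) ⇔ (Coprime k m × Coprime k n)
coprime-*⇔ {k} {m} {n} = mk⇔ split join
  where
  split : Coprime k (m * n) → Coprime k m × Coprime k n
  split k⊥mn = (λ (i∣k , i∣m) → k⊥mn (i∣k , ∣m⇒∣m*n n i∣m))
             , (λ (i∣k , i∣n) → k⊥mn (i∣k , ∣n⇒∣m*n m i∣n))
  join : Coprime k m × Coprime k n → Coprime k (m * n)
  join (k⊥m , k⊥n) {i} (i∣k , i∣mn) = k⊥n (i∣k , coprime-divisor i⊥m i∣mn)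
    where
    i⊥m : Coprime i m
    i⊥m (j∣i , j∣m) = k⊥m (∣-trans j∣i i∣k , j∣m)

coprime-prime*⇔ : ∀ {p k m} → Prime p → Coprime k (p * m) ⇔ (Coprime k m × p ∤ k)
coprime-prime*⇔ {p} {k} {m} p-prime = mk⇔ split join
  where
  split : Coprime k (p * m) → Coprime k m × p ∤ k
  split k⊥pm with to coprime-*⇔ k⊥pm
  ... | k⊥p , k⊥m = k⊥m , to (prime-coprime⇔∤ p-prime) (coprime-sym k⊥p)
  join : Coprime k m × p ∤ k → Coprime k (p * m)
  join (k⊥m , p∤k) = from coprime-*⇔ (coprime-sym (from (prime-coprime⇔∤ p-prime) p∤k) , k⊥m)

coprime-*prime⇔ : ∀ {p j m} → Prime p → p ∤ m → Coprime (j * p) m ⇔ Coprime j m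
coprime-*prime⇔ {p} {j} {m} p-prime p∤m = mk⇔ drop add
  where
  drop : Coprime (j * p) m → Coprime j m
  drop jp⊥m = coprime-sym (proj₁ (to coprime-*⇔ (coprime-sym jp⊥m)))
  add : Coprime j m → Coprime (j * p) m
  add j⊥m = coprime-sym (from coprime-*⇔ (coprime-sym j⊥m , m⊥p))
    where
    m⊥p : Coprime m p
    m⊥p = coprime-sym (from (prime-coprime⇔∤ p-prime) p∤m)

-- Counting

indicator : Bool → ℕ
indicator b = if b then 1 else 0

count : (ℕ → Bool) → ℕ → ℕ
count f zero    = 0
count f (suc n) = indicator (f 1) + count (f ∘ suc) n

length-filter≡count : ∀ {a ℓ} {A : Set a} {P : Pred A ℓ} (P? : Decidable P) (g : ℕ → A) n →
                      length (filter P? (applyUpTo (g ∘ suc) n)) ≡ count (λ k → does (P? (g k))) n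
length-filter≡count P? g zero = refl
length-filter≡count P? g (suc n) with P? (g 1)
... | yes _ = cong suc (length-filter≡count P? (g ∘ suc) n)
... | no  _ = length-filter≡count P? (g ∘ suc) n

count-cong : ∀ {f g} → (∀ k → f k ≡ g k) → ∀ n → count f n ≡ count g n
count-cong f≗g zero    = refl
count-cong f≗g (suc n) = cong₂ (λ b c → indicator b + c) (f≗g 1) (count-cong (f≗g ∘ suc) n)

count-false : ∀ {f n} → (∀ {k} → 1 ≤ k → k ≤ n → f k ≡ false) → count f n ≡ 0
count-false {n = zero}      _ = refl
count-false {f} {n = suc n} f≡false rewrite f≡false (s≤s z≤n) (s≤s z≤n) =
  count-false {f ∘ suc} λ {k} _ k≤n → f≡false (s≤s z≤n) (s≤s k≤n)

count-+ : ∀ f m n → count f (m + n) ≡ count f m + count (λ k → f (m + k)) n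
count-+ f zero    n = refl
count-+ f (suc m) n = trans (cong (indicator (f 1) +_) (count-+ (f ∘ suc) m n))
                            (sym (+-assoc (indicator (f 1)) _ _))

count-suc : ∀ f n → count f (suc n) ≡ count f n + indicator (f (suc n))
count-suc f zero    = +-comm (indicator (f 1)) 0
count-suc f (suc n) = trans (cong (indicator (f 1) +_) (count-suc (f ∘ suc) n))
                            (sym (+-assoc (indicator (f 1)) _ _))

count-periodic : ∀ {f m} → (∀ k → f (m + k) ≡ f k) → ∀ a → count f (a * m) ≡ a * count f m
count-periodic         f-per zero    = refl
count-periodic {f} {m} f-per (suc a) = begin
  count f (m + a * m)                          ≡⟨ count-+ f m (a * m) ⟩
  count f m + count (λ k → f (m + k)) (a * m)  ≡⟨ cong (count f m +_) (count-cong f-per (a * m)) ⟩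
  count f m + count f (a * m)                  ≡⟨ cong (count f m +_) (count-periodic f-per a) ⟩
  count f m + a * count f m                    ∎
  where open ≡-Reasoning

count-split : ∀ f g n → count f n ≡ count (λ k → f k ∧ g k) n + count (λ k → f k ∧ not (g k)) n
count-split f g zero = refl
count-split f g (suc n) with f 1 | g 1 | count-split (f ∘ suc) (g ∘ suc) n
... | true  | true  | split = cong suc split
... | true  | false | split = trans (cong suc split) (sym (+-suc _ _))
... | false | _     | split = split

count-multiples-block : ∀ (f : ℕ → Bool) r .{{_ : NonZero r}} →
                        count (λ k → f k ∧ does (r ∣? k)) r ≡ indicator (f r)
count-multiples-block f r@(suc r′) = begin
  count g (suc r′)                ≡⟨ count-suc g r′ ⟩
  count g r′ + indicator (g r)    ≡⟨ cong₂ _+_ (count-false r∤k) (cong indicator g[r]≡f[r]) ⟩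
  indicator (f r)                 ∎
  where
  open ≡-Reasoning
  g : ℕ → Bool
  g k = f k ∧ does (r ∣? k)
  r∤k : ∀ {k} → 1 ≤ k → k ≤ r′ → g k ≡ false
  r∤k {k} 1≤k k≤r′ =
    trans (cong (f k ∧_) (dec-false (r ∣? k) (>⇒∤ {{>-nonZero 1≤k}} (s≤s k≤r′)))) (∧-zeroʳ (f k))
  g[r]≡f[r] : g r ≡ f r
  g[r]≡f[r] = trans (cong (f r ∧_) (dec-true (r ∣? r) ∣-refl)) (∧-identityʳ (f r))

count-multiples : ∀ (f : ℕ → Bool) r .{{_ : NonZero r}} n →
                  count (λ k → f k ∧ does (r ∣? k)) (n * r) ≡ count (λ j → f (j * r)) n
count-multiples f r zero    = refl
count-multiples f r (suc n) = begin
  count g (r + n * r)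
    ≡⟨ count-+ g r (n * r) ⟩
  count g r + count (λ k → g (r + k)) (n * r)
    ≡⟨ cong₂ _+_ (count-multiples-block f r) (count-cong shift (n * r)) ⟩
  indicator (f r) + count (λ k → f (r + k) ∧ does (r ∣? k)) (n * r)
    ≡⟨ cong₂ _+_ (cong (indicator ∘ f) (sym (*-identityˡ r))) (count-multiples (λ k → f (r + k)) r n) ⟩
  indicator (f (1 * r)) + count (λ j → f (r + j * r)) n
    ∎
  where
  open ≡-Reasoning
  g : ℕ → Bool
  g k = f k ∧ does (r ∣? k)
  r∣r+k⇔r∣k : ∀ k → r ∣ r + k ⇔ r ∣ k
  r∣r+k⇔r∣k k = mk⇔ (λ r∣r+k → ∣m+n∣m⇒∣n r∣r+k ∣-refl) (∣m∣n⇒∣m+n ∣-refl)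
  shift : ∀ k → g (r + k) ≡ f (r + k) ∧ does (r ∣? k)
  shift k = cong (f (r + k) ∧_) (does-⇔ (r∣r+k⇔r∣k k) (r ∣? (r + k)) (r ∣? k))

-- Euler's totient

coprimeTo : ℕ → ℕ → Bool
coprimeTo m k = does (coprime? k m)

coprimeTo-+ : ∀ m k → coprimeTo m (m + k) ≡ coprimeTo m k
coprimeTo-+ m k = does-⇔ (mk⇔ drop coprime-+) (coprime? (m + k) m) (coprime? k m)
  where
  drop : Coprime (m + k) m → Coprime k m
  drop m+k⊥m (i∣k , i∣m) = m+k⊥m (∣m∣n⇒∣m+n i∣m i∣k , i∣m)

coprimeTo-prime* : ∀ {p} → Prime p → ∀ m k → coprimeTo (p * m) k ≡ coprimeTo m k ∧ not (does (p ∣? k))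
coprimeTo-prime* {p} p-prime m k =
  does-⇔ (coprime-prime*⇔ p-prime) (coprime? k (p * m)) (coprime? k m ×-dec ¬? (p ∣? k))

coprimeTo-*prime : ∀ {p m} → Prime p → p ∤ m → ∀ j → coprimeTo m (j * p) ≡ coprimeTo m j
coprimeTo-*prime {p} {m} p-prime p∤m j =
  does-⇔ (coprime-*prime⇔ p-prime p∤m) (coprime? (j * p) m) (coprime? j m)

φ≡count : ∀ m → φ m ≡ count (coprimeTo m) m
φ≡count m = trans (cong (length ∘ filter _) (map-upTo suc m))
                  (length-filter≡count (λ k → gcd k m ≟ 1) id m)

count-coprimeTo : ∀ a m → count (coprimeTo m) (a * m) ≡ a * φ m
count-coprimeTo a m = trans (count-periodic (coprimeTo-+ m) a) (cong (a *_) (sym (φ≡count m)))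

φ-prime*-split : ∀ {p} → Prime p → ∀ m → count (λ j → coprimeTo m (j * p)) m + φ (p * m) ≡ p * φ m
φ-prime*-split {p} p-prime m = begin
  count (λ j → c (j * p)) m + φ (p * m)
    ≡⟨ cong₂ _+_ multiples non-multiples ⟨
  count (λ k → c k ∧ does (p ∣? k)) (p * m) + count (λ k → c k ∧ not (does (p ∣? k))) (p * m)
    ≡⟨ count-split c (λ k → does (p ∣? k)) (p * m) ⟨
  count c (p * m)
    ≡⟨ count-coprimeTo p m ⟩
  p * φ m
    ∎
  where
  open ≡-Reasoning
  instance _ = prime⇒nonZero p-prime
  c : ℕ → Bool
  c = coprimeTo m
  multiples : count (λ k → c k ∧ does (p ∣? k)) (p * m) ≡ count (λ j → c (j * p)) m
  multiples = trans (cong (count _) (*-comm p m)) (count-multiples c p m)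
  non-multiples : count (λ k → c k ∧ not (does (p ∣? k))) (p * m) ≡ φ (p * m)
  non-multiples = sym (trans (φ≡count (p * m)) (count-cong (coprimeTo-prime* p-prime m) (p * m)))

φ-prime*-∣ : ∀ {p m} → Prime p → p ∣ m → φ (p * m) ≡ p * φ m
φ-prime*-∣ {p} {m} p-prime p∣m = begin
  φ (p * m)                                        ≡⟨ cong (_+ φ (p * m)) no-coprime-multiples ⟨
  count (λ j → coprimeTo m (j * p)) m + φ (p * m)  ≡⟨ φ-prime*-split p-prime m ⟩
  p * φ m                                          ∎
  where
  open ≡-Reasoning
  no-coprime-multiples : count (λ j → coprimeTo m (j * p)) m ≡ 0
  no-coprime-multiples = count-false {n = m} λ {j} _ _ →
    dec-false (coprime? (j * p) m) (λ jp⊥m → prime⇒≢1 p-prime (jp⊥m (n∣m*n j , p∣m)))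

φ-prime*-∤ : ∀ {p m} → Prime p → p ∤ m → φ (p * m) ≡ (p ∸ 1) * φ m
φ-prime*-∤ {p} {m} p-prime p∤m = begin
  φ (p * m)                                              ≡⟨ m+n∸m≡n (φ m) (φ (p * m)) ⟨
  φ m + φ (p * m) ∸ φ m                                  ≡⟨ cong (λ c → c + φ (p * m) ∸ φ m) coprime-multiples ⟨
  count (λ j → coprimeTo m (j * p)) m + φ (p * m) ∸ φ m  ≡⟨ cong (_∸ φ m) (φ-prime*-split p-prime m) ⟩
  p * φ m ∸ φ m                                          ≡⟨ cong (p * φ m ∸_) (*-identityˡ (φ m)) ⟨
  p * φ m ∸ 1 * φ m                                      ≡⟨ *-distribʳ-∸ (φ m) p 1 ⟨
  (p ∸ 1) * φ m                                          ∎
  where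
  open ≡-Reasoning
  coprime-multiples : count (λ j → coprimeTo m (j * p)) m ≡ φ m
  coprime-multiples = trans (count-cong (coprimeTo-*prime p-prime p∤m) m) (sym (φ≡count m))

φ-prime : ∀ {p} → Prime p → φ p ≡ p ∸ 1
φ-prime {p} p-prime = begin
  φ p          ≡⟨ cong φ (*-identityʳ p) ⟨
  φ (p * 1)    ≡⟨ φ-prime*-∤ p-prime (prime⇒≢1 p-prime ∘ ∣1⇒≡1) ⟩
  (p ∸ 1) * 1  ≡⟨ *-identityʳ (p ∸ 1) ⟩
  p ∸ 1        ∎
  where open ≡-Reasoning

φ∣φ[prime*] : ∀ {p} → Prime p → ∀ m → φ m ∣ φ (p * m)
φ∣φ[prime*] {p} p-prime m with p ∣? m
... | yes p∣m = subst (φ m ∣_) (sym (φ-prime*-∣ p-prime p∣m)) (n∣m*n p)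
... | no  p∤m = subst (φ m ∣_) (sym (φ-prime*-∤ p-prime p∤m)) (n∣m*n (p ∸ 1))

φ∣φ[product*] : ∀ {ps} → All Prime ps → ∀ n → φ n ∣ φ (product ps * n)
φ∣φ[product*] []                              n = ∣-reflexive (cong φ (sym (*-identityˡ n)))
φ∣φ[product*] (_∷_ {p} {ps} p-prime ps-prime) n = ∣-trans (φ∣φ[product*] ps-prime n)
  (subst (φ (product ps * n) ∣_) (cong φ (sym (*-assoc p (product ps) n)))
    (φ∣φ[prime*] p-prime (product ps * n)))

φ∣φ[m*n] : ∀ m n → φ n ∣ φ (m * n)
φ∣φ[m*n] zero      n = φ n ∣0
φ∣φ[m*n] m@(suc _) n =
  subst (λ x → φ n ∣ φ (x * n)) (sym isFactorisation) (φ∣φ[product*] factorsPrime n)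
  where open PrimeFactorisation (factorise m)

pred∣φ : ∀ {p x} → Prime p → p ∣ x → p ∸ 1 ∣ φ x
pred∣φ {p} p-prime (divides-refl q) = subst (_∣ φ (q * p)) (φ-prime p-prime) (φ∣φ[m*n] q p)

prime*pred∣φ : ∀ {p x} → Prime p → p * p ∣ x → p * (p ∸ 1) ∣ φ x
prime*pred∣φ {p} p-prime (divides-refl q) =
  subst (p * (p ∸ 1) ∣_) (trans (sym (φ-prime*-∣ p-prime (n∣m*n q))) (cong φ p*[q*p]≡q*[p*p]))
    (*-monoʳ-∣ p (pred∣φ p-prime (n∣m*n q)))
  where
  p*[q*p]≡q*[p*p] : p * (q * p) ≡ q * (p * p)
  p*[q*p]≡q*[p*p] = trans (*-comm p (q * p)) (*-assoc q p p)

data Explains∣φ (p x : ℕ) : Set where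
  square∣      : p * p ∣ x → Explains∣φ p x
  prime-factor : ∀ {r} → Prime r → r ∣ x → p ∣ r ∸ 1 → Explains∣φ p x

explains∣φ-multiple : ∀ {p x y} → y ∣ x → Explains∣φ p y → Explains∣φ p x
explains∣φ-multiple y∣x (square∣ p²∣y)                   = square∣ (∣-trans p²∣y y∣x)
explains∣φ-multiple y∣x (prime-factor r-prime r∣y p∣r∸1) = prime-factor r-prime (∣-trans r∣y y∣x) p∣r∸1

explains∣φ-product : ∀ {p rs} → Prime p → All Prime rs →
                     p ∣ φ (product rs) → Explains∣φ p (product rs)
explains∣φ-product p-prime [] p∣φ[1] = contradiction (∣1⇒≡1 p∣φ[1]) (prime⇒≢1 p-prime)
explains∣φ-product {p} p-prime (_∷_ {r} {rs} r-prime rs-prime) p∣φ with r ∣? product rs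
... | yes r∣m
    with euclidsLemma r (φ (product rs)) p-prime (subst (p ∣_) (φ-prime*-∣ r-prime r∣m) p∣φ)
...   | inj₁ p∣r  = square∣ (*-pres-∣ p∣r (∣-trans p∣r r∣m))
...   | inj₂ p∣φm = explains∣φ-multiple (n∣m*n r) (explains∣φ-product p-prime rs-prime p∣φm)
explains∣φ-product {p} p-prime (_∷_ {r} {rs} r-prime rs-prime) p∣φ
    | no r∤m
    with euclidsLemma (r ∸ 1) (φ (product rs)) p-prime (subst (p ∣_) (φ-prime*-∤ r-prime r∤m) p∣φ)
...   | inj₁ p∣r∸1 = prime-factor r-prime (m∣m*n (product rs)) p∣r∸1
...   | inj₂ p∣φm  = explains∣φ-multiple (n∣m*n r) (explains∣φ-product p-prime rs-prime p∣φm)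

explains∣φ : ∀ {p x} → Prime p → p ∣ φ x → Explains∣φ p x
explains∣φ {p} {zero}      _       _    = square∣ ((p * p) ∣0)
explains∣φ {p} {x@(suc _)} p-prime p∣φx =
  subst (Explains∣φ p) (sym isFactorisation)
    (explains∣φ-product p-prime factorsPrime (subst (λ y → p ∣ φ y) isFactorisation p∣φx))
  where open PrimeFactorisation (factorise x)

-- Divisors of 4p

∣4⇒ : ∀ {d} → d ∣ 4 → d ≡ 1 ⊎ d ≡ 2 ⊎ d ≡ 4
∣4⇒ {0} 0∣4 = contradiction (0∣⇒≡0 0∣4) λ ()
∣4⇒ {1} _   = inj₁ refl
∣4⇒ {2} _   = inj₂ (inj₁ refl)
∣4⇒ {3} 3∣4 = contradiction 3∣4 (from-no (3 ∣? 4))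
∣4⇒ {4} _   = inj₂ (inj₂ refl)
∣4⇒ {suc (suc (suc (suc (suc d))))} d∣4 = contradiction d∣4 (>⇒∤ (m≤m+n 5 d))

∣*prime⇒ : ∀ {p d n} → Prime p → d ∣ n * p → d ∣ n ⊎ ∃ λ e → e ∣ n × d ≡ e * p
∣*prime⇒ {p} {d} {n} p-prime d∣np with p ∣? d
... | yes (divides-refl e) = inj₂ (e , *-cancelʳ-∣ p {{prime⇒nonZero p-prime}} d∣np , refl)
... | no  p∤d              = inj₁ (coprime-divisor d⊥p (subst (d ∣_) (*-comm n p) d∣np))
  where
  d⊥p : Coprime d p
  d⊥p = coprime-sym (from (prime-coprime⇔∤ p-prime) p∤d)

2∤⇒2∣suc : ∀ {n} → 2 ∤ n → 2 ∣ suc n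
2∤⇒2∣suc {0}    2∤0   = contradiction (2 ∣0) 2∤0
2∤⇒2∣suc {1}    _     = ∣-refl
2∤⇒2∣suc {2+ n} 2∤2+n = ∣m∣n⇒∣m+n {2} {2} ∣-refl (2∤⇒2∣suc (2∤2+n ∘ ∣m∣n⇒∣m+n ∣-refl))

2∣⇒2∤+1 : ∀ {n} → 2 ∣ n → 2 ∤ n + 1
2∣⇒2∤+1 2∣n 2∣n+1 = contradiction (∣1⇒≡1 (∣m+n∣m⇒∣n 2∣n+1 2∣n)) λ ()

prime-pred∣4p : ∀ {p q} → Prime p → 2 ∤ p → Prime q → q ∸ 1 ∣ 4 * p →
                q ≡ 2 ⊎ q ≡ 3 ⊎ q ≡ 5 ⊎ q ≡ 2 * p + 1 ⊎ q ≡ 4 * p + 1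
prime-pred∣4p {p} {zero}  _       _     q-prime _    = contradiction q-prime ¬prime[0]
prime-pred∣4p {p} {suc d} p-prime p-odd q-prime d∣4p with ∣*prime⇒ p-prime d∣4p
... | inj₁ d∣4 with ∣4⇒ d∣4
...   | inj₁ refl        = inj₁ refl
...   | inj₂ (inj₁ refl) = inj₂ (inj₁ refl)
...   | inj₂ (inj₂ refl) = inj₂ (inj₂ (inj₁ refl))
prime-pred∣4p {p} {suc d} p-prime p-odd q-prime d∣4p | inj₂ (e , e∣4 , refl) with ∣4⇒ e∣4
...   | inj₁ refl        = inj₁ (sym (∣-prime⇒≡ prime[2] q-prime 2∣p+1))
  where
  2∣p+1 : 2 ∣ suc (p + 0)
  2∣p+1 = subst (λ m → 2 ∣ suc m) (sym (+-identityʳ p)) (2∤⇒2∣suc p-odd)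
...   | inj₂ (inj₁ refl) = inj₂ (inj₂ (inj₂ (inj₁ (+-comm 1 (2 * p)))))
...   | inj₂ (inj₂ refl) = inj₂ (inj₂ (inj₂ (inj₂ (+-comm 1 (4 * p)))))

3∣p⊎3∣2p+1⊎3∣4p+1 : ∀ p → 3 ∣ p ⊎ 3 ∣ 2 * p + 1 ⊎ 3 ∣ 4 * p + 1
3∣p⊎3∣2p+1⊎3∣4p+1 p with p divMod 3
... | result h zero             p≡3h   = inj₁ (divides h p≡3h)
... | result h (suc zero)       p≡3h+1 =
  inj₂ (inj₁ (divides (2 * h + 1) (trans (cong (λ m → 2 * m + 1) p≡3h+1) (2[1+3h]+1 h))))
  where
  2[1+3h]+1 : ∀ h → 2 * (1 + h * 3) + 1 ≡ (2 * h + 1) * 3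
  2[1+3h]+1 = solve-∀
... | result h (suc (suc zero)) p≡3h+2 =
  inj₂ (inj₂ (divides (4 * h + 3) (trans (cong (λ m → 4 * m + 1) p≡3h+2) (4[2+3h]+1 h))))
  where
  4[2+3h]+1 : ∀ h → 4 * (2 + h * 3) + 1 ≡ (4 * h + 3) * 3
  4[2+3h]+1 = solve-∀

3<k*p+1 : ∀ {k p} → 2 ≤ k → 1 < p → 3 < k * p + 1
3<k*p+1 {k} {p} 2≤k 1<p = ≤-trans (*-mono-≤ 2≤k 1<p) (m≤m+n (k * p) 1)

prime[2p+1]⇒¬prime[4p+1] : ∀ {p} → Prime p → p ≢ 3 → Prime (2 * p + 1) → ¬ Prime (4 * p + 1)
prime[2p+1]⇒¬prime[4p+1] {p} p-prime p≢3 2p+1-prime 4p+1-prime with 3∣p⊎3∣2p+1⊎3∣4p+1 p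
... | inj₁ 3∣p =
  p≢3 (sym (∣-prime⇒≡ prime[3] p-prime 3∣p))
... | inj₂ (inj₁ 3∣2p+1) =
  <⇒≢ (3<k*p+1 ≤-refl (prime⇒>1 p-prime)) (∣-prime⇒≡ prime[3] 2p+1-prime 3∣2p+1)
... | inj₂ (inj₂ 3∣4p+1) =
  <⇒≢ (3<k*p+1 {4} (s≤s (s≤s z≤n)) (prime⇒>1 p-prime)) (∣-prime⇒≡ prime[3] 4p+1-prime 3∣4p+1)

-- Toda primes

4p≡2*[2p+1∸1] : ∀ p → 4 * p ≡ 2 * (2 * p + 1 ∸ 1)
4p≡2*[2p+1∸1] p = trans (*-assoc 2 2 p) (cong (2 *_) (sym (m+n∸n≡m (2 * p) 1)))

isTodaPrime-3 : ∀ {p} → Prime p → p ≢ 3 → IsTodaPrime p 3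
isTodaPrime-3 {p} p-prime p≢3 =
  prime[3] , from-no (2 ∣? 3) , 2 * p , 4p≡2p*2 p , coprime⇒gcd≡1 (from (prime-coprime⇔∤ prime[3]) 3∤2p)
  where
  4p≡2p*2 : ∀ p → 4 * p ≡ 2 * p * 2
  4p≡2p*2 = solve-∀
  3∤2p : 3 ∤ 2 * p
  3∤2p 3∣2p = [ from-no (3 ∣? 2) , p≢3 ∘ sym ∘ ∣-prime⇒≡ prime[3] p-prime ]′
                (euclidsLemma 2 p prime[3] 3∣2p)

isTodaPrime-5 : ∀ {p} → Prime p → p ≢ 5 → IsTodaPrime p 5
isTodaPrime-5 {p} p-prime p≢5 =
  prime[5] , from-no (2 ∣? 5) , p , *-comm 4 p , coprime⇒gcd≡1 (from (prime-coprime⇔∤ prime[5]) 5∤p)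
  where
  5∤p : 5 ∤ p
  5∤p = p≢5 ∘ sym ∘ ∣-prime⇒≡ prime[5] p-prime

isTodaPrime-2p+1 : ∀ {p} → Prime (2 * p + 1) → IsTodaPrime p (2 * p + 1)
isTodaPrime-2p+1 {p} 2p+1-prime =
  2p+1-prime , 2∤2p+1 , 2 , 4p≡2*[2p+1∸1] p ,
  coprime⇒gcd≡1 (coprime-sym (from (prime-coprime⇔∤ prime[2]) 2∤2p+1))
  where
  2∤2p+1 : 2 ∤ 2 * p + 1
  2∤2p+1 = 2∣⇒2∤+1 (m∣m*n p)

isTodaPrime-4p+1 : ∀ {p} → Prime (4 * p + 1) → IsTodaPrime p (4 * p + 1)
isTodaPrime-4p+1 {p} 4p+1-prime =
  4p+1-prime , 2∣⇒2∤+1 (∣m⇒∣m*n p (divides 2 refl)) , 1 ,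
  sym (trans (*-identityˡ _) (m+n∸n≡m (4 * p) 1)) , gcd-zeroʳ (4 * p + 1)

module _ {p} (p-prime : Prime p) (7≤p : 7 ≤ p) where

  private
    <p : ∀ {n} → n ≤ 4 → n < p
    <p n≤4 = ≤-trans (s≤s n≤4) (≤-trans (m≤m+n 5 2) 7≤p)

    p≢3 : p ≢ 3
    p≢3 = >⇒≢ (<p (n≤1+n 3))

    p≢5 : p ≢ 5
    p≢5 = >⇒≢ (≤-trans (n≤1+n 6) 7≤p)

    p-odd : 2 ∤ p
    p-odd = >⇒≢ (<p (m≤m+n 2 2)) ∘ sym ∘ ∣-prime⇒≡ prime[2] p-prime

    p∤≤4 : ∀ {d} .{{_ : NonZero d}} → d ≤ 4 → p ∤ d
    p∤≤4 d≤4 = >⇒∤ (<p d≤4)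

  isTodaPrime⇒ : ∀ {q} → IsTodaPrime p q → q ≡ 3 ⊎ q ≡ 5 ⊎ q ≡ 2 * p + 1 ⊎ q ≡ 4 * p + 1
  isTodaPrime⇒ (q-prime , q-odd , k , 4p≡k*[q∸1] , _) =
    [ (λ q≡2 → contradiction (subst (2 ∣_) (sym q≡2) ∣-refl) q-odd) , id ]′
      (prime-pred∣4p p-prime p-odd q-prime (divides k 4p≡k*[q∸1]))

  todaPrimes-2p+1 : Prime (2 * p + 1) → ∀ q → IsTodaPrime p q ⇔ (q ≡ 3 ⊎ q ≡ 5 ⊎ q ≡ 2 * p + 1)
  todaPrimes-2p+1 2p+1-prime q = mk⇔
    (λ t → map₂ (map₂ [ id , (λ q≡4p+1 → contradiction (subst Prime q≡4p+1 (proj₁ t)) ¬4p+1-prime) ]′)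
                (isTodaPrime⇒ t))
    λ { (inj₁ refl)        → isTodaPrime-3 p-prime p≢3
      ; (inj₂ (inj₁ refl)) → isTodaPrime-5 p-prime p≢5
      ; (inj₂ (inj₂ refl)) → isTodaPrime-2p+1 {p} 2p+1-prime
      }
    where
    ¬4p+1-prime : ¬ Prime (4 * p + 1)
    ¬4p+1-prime = prime[2p+1]⇒¬prime[4p+1] p-prime p≢3 2p+1-prime

  todaPrimes-4p+1 : Prime (4 * p + 1) → ∀ q → IsTodaPrime p q ⇔ (q ≡ 3 ⊎ q ≡ 5 ⊎ q ≡ 4 * p + 1)
  todaPrimes-4p+1 4p+1-prime q = mk⇔
    (λ t → map₂ (map₂ [ (λ q≡2p+1 → contradiction (subst Prime q≡2p+1 (proj₁ t)) ¬2p+1-prime) , id ]′)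
               (isTodaPrime⇒ t))
    λ { (inj₁ refl)        → isTodaPrime-3 p-prime p≢3
      ; (inj₂ (inj₁ refl)) → isTodaPrime-5 p-prime p≢5
      ; (inj₂ (inj₂ refl)) → isTodaPrime-4p+1 {p} 4p+1-prime
      }
    where
    ¬2p+1-prime : ¬ Prime (2 * p + 1)
    ¬2p+1-prime 2p+1-prime = prime[2p+1]⇒¬prime[4p+1] p-prime p≢3 2p+1-prime 4p+1-prime

  todaPrimes-3-5 : ¬ Prime (2 * p + 1) → ¬ Prime (4 * p + 1) →
                   ∀ q → IsTodaPrime p q ⇔ (q ≡ 3 ⊎ q ≡ 5)
  todaPrimes-3-5 ¬2p+1-prime ¬4p+1-prime q = mk⇔
    (λ t → map₂ [ id , ⊥-elim ∘ ¬large (proj₁ t) ]′ (isTodaPrime⇒ t))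
    λ { (inj₁ refl) → isTodaPrime-3 p-prime p≢3
      ; (inj₂ refl) → isTodaPrime-5 p-prime p≢5
      }
    where
    ¬large : Prime q → ¬ (q ≡ 2 * p + 1 ⊎ q ≡ 4 * p + 1)
    ¬large q-prime = [ (λ q≡2p+1 → ¬2p+1-prime (subst Prime q≡2p+1 q-prime))
                     , (λ q≡4p+1 → ¬4p+1-prime (subst Prime q≡4p+1 q-prime)) ]′

  φ≡4p⇒ : ∀ {x} → φ x ≡ 4 * p → Prime (2 * p + 1) ⊎ Prime (4 * p + 1)
  φ≡4p⇒ {x} φx≡4p with explains∣φ {x = x} p-prime (subst (p ∣_) (sym φx≡4p) (n∣m*n 4))
  ... | square∣ p²∣x = contradiction p∸1∣4 (>⇒∤ (≤-trans (n≤1+n 5) (∸-monoˡ-≤ 1 7≤p)))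
    where
    p∸1∣4 : p ∸ 1 ∣ 4
    p∸1∣4 = *-cancelˡ-∣ p {{prime⇒nonZero p-prime}}
              (subst (p * (p ∸ 1) ∣_) (trans φx≡4p (*-comm 4 p)) (prime*pred∣φ p-prime p²∣x))
  ... | prime-factor {r} r-prime r∣x p∣r∸1
      with prime-pred∣4p p-prime p-odd r-prime (subst (r ∸ 1 ∣_) φx≡4p (pred∣φ r-prime r∣x))
  ...   | inj₁ refl                      = contradiction p∣r∸1 (p∤≤4 (s≤s z≤n))
  ...   | inj₂ (inj₁ refl)               = contradiction p∣r∸1 (p∤≤4 (s≤s (s≤s z≤n)))
  ...   | inj₂ (inj₂ (inj₁ refl))        = contradiction p∣r∸1 (p∤≤4 ≤-refl)
  ...   | inj₂ (inj₂ (inj₂ (inj₁ refl))) = inj₁ r-prime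
  ...   | inj₂ (inj₂ (inj₂ (inj₂ refl))) = inj₂ r-prime

  φ≡4p-solvable⇔ : (∃ λ x → 1 ≤ x × φ x ≡ 4 * p) ⇔ (Prime (2 * p + 1) ⊎ Prime (4 * p + 1))
  φ≡4p-solvable⇔ = mk⇔ (λ (x , _ , φx≡4p) → φ≡4p⇒ {x} φx≡4p) [ solution-2p+1 , solution-4p+1 ]′
    where
    solution-2p+1 : Prime (2 * p + 1) → ∃ λ x → 1 ≤ x × φ x ≡ 4 * p
    solution-2p+1 2p+1-prime =
      3 * (2 * p + 1) , ≤-trans (m≤n+m 1 (2 * p)) (m≤m+n (2 * p + 1) _) , (begin
        φ (3 * (2 * p + 1))  ≡⟨ φ-prime*-∤ prime[3] 3∤2p+1 ⟩
        2 * φ (2 * p + 1)    ≡⟨ cong (2 *_) (φ-prime 2p+1-prime) ⟩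
        2 * (2 * p + 1 ∸ 1)  ≡⟨ 4p≡2*[2p+1∸1] p ⟨
        4 * p                ∎)
      where
      open ≡-Reasoning
      3∤2p+1 : 3 ∤ 2 * p + 1
      3∤2p+1 = <⇒≢ (3<k*p+1 ≤-refl (prime⇒>1 p-prime)) ∘ ∣-prime⇒≡ prime[3] 2p+1-prime
    solution-4p+1 : Prime (4 * p + 1) → ∃ λ x → 1 ≤ x × φ x ≡ 4 * p
    solution-4p+1 4p+1-prime =
      4 * p + 1 , m≤n+m 1 (4 * p) , trans (φ-prime 4p+1-prime) (m+n∸n≡m (4 * p) 1)

proposition5p1 : (p : ℕ) → Prime p → 7 ≤ p →
    ((∃ λ x → 1 ≤ x × φ x ≡ 4 * p) →
      ((∀ q → IsTodaPrime p q ⇔ (q ≡ 3 ⊎ q ≡ 5 ⊎ q ≡ 2 * p + 1))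
       ⊎ (∀ q → IsTodaPrime p q ⇔ (q ≡ 3 ⊎ q ≡ 5 ⊎ q ≡ 4 * p + 1))))
    × (¬ (∃ λ x → 1 ≤ x × φ x ≡ 4 * p) →
      (∀ q → IsTodaPrime p q ⇔ (q ≡ 3 ⊎ q ≡ 5)))
proposition5p1 p p-prime 7≤p = solvable , unsolvable
  where
  solvable⇔ : (∃ λ x → 1 ≤ x × φ x ≡ 4 * p) ⇔ (Prime (2 * p + 1) ⊎ Prime (4 * p + 1))
  solvable⇔ = φ≡4p-solvable⇔ p-prime 7≤p
  solvable : (∃ λ x → 1 ≤ x × φ x ≡ 4 * p) →
             (∀ q → IsTodaPrime p q ⇔ (q ≡ 3 ⊎ q ≡ 5 ⊎ q ≡ 2 * p + 1))
             ⊎ (∀ q → IsTodaPrime p q ⇔ (q ≡ 3 ⊎ q ≡ 5 ⊎ q ≡ 4 * p + 1))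
  solvable = Sum.map (todaPrimes-2p+1 p-prime 7≤p) (todaPrimes-4p+1 p-prime 7≤p) ∘ to solvable⇔
  unsolvable : ¬ (∃ λ x → 1 ≤ x × φ x ≡ 4 * p) → ∀ q → IsTodaPrime p q ⇔ (q ≡ 3 ⊎ q ≡ 5)
  unsolvable ∄x =
    todaPrimes-3-5 p-prime 7≤p (∄x ∘ from solvable⇔ ∘ inj₁) (∄x ∘ from solvable⇔ ∘ inj₂)
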